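{- Let $\Gamma$ be a finite, simple, connected, undirected $2$-distance-transitive graph of valency $k\ge3$. Then: (1) if $a_1\ge1$ and the local graph $[\Gamma(u)]$ is disconnected for some vertex $u$, then $\Gamma$ is not locally-primitive; (2) if $a_1=1$, then $\Gamma$ is not locally-primitive; (3) if $a_1\ge c_2=1$, then $\Gamma$ is not locally-primitive; (4) if $c_2=1$, then either $\Gamma$ is $2$-arc-transitive, or $\Gamma$ is neither $2$-arc-transitive nor locally-primitive.
   Context: $\Gamma$ is $2$-distance-transitive if it has diameter at least $2$, $\mathrm{Aut}(\Gamma)$ is vertex-transitive, and each $\mathrm{Aut}(\Gamma)_u$ is transitive on the vertices at distance $1$ and at distance $2$ from $u$. $a_1$ is the number of common neighbours of two adjacent vertices; $c_2$ is the number of common neighbours of two vertices at distance $2$. $[\Gamma(u)]$ is the subgraph induced on the neighbourhood of $u$. $\Gamma$ is locally-primitive if each $\mathrm{Aut}(\Gamma)_u$ acts primitively on the neighbourhood of $u$. $\Gamma$ is $2$-arc-transitive if $\mathrm{Aut}(\Gamma)$ is transitive on vertices and on sequences $(u_0,u_1,u_2)$ with $u_0\sim u_1\sim u_2$, $u_0\ne u_2$. -}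

module Defs where

open import Data.Nat using (ℕ; zero; suc; _<_; _≤_)
open import Data.Fin using (Fin)
open import Data.Fin.Permutation using (Permutation′; _⟨$⟩ʳ_)
open import Data.Fin.Subset using (Subset; _∈_; _∉_)
open import Data.List using (List; length; filter)
open import Data.List using () renaming (allFin to allFinL)
open import Data.Product using (Σ; ∃; _×_; _,_)
open import Data.Sum using (_⊎_)
open import Relation.Nullary using (¬_; Dec)
open import Relation.Nullary.Decidable using (_×-dec_)
open import Relation.Binary.PropositionalEquality using (_≡_)

record Graph (n : ℕ) : Set₁ where
  field
    Adj    : Fin n → Fin n → Set
    adj?   : ∀ u v → Dec (Adj u v)
    sym    : ∀ {u v} → Adj u v → Adj v u
    irrefl : ∀ {u} → ¬ Adj u u
open Graph public

module _ {n : ℕ} (G : Graph n) where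

  data Walk : Fin n → Fin n → ℕ → Set where
    here : ∀ {u} → Walk u u zero
    step : ∀ {u v w ℓ} → Adj G u v → Walk v w ℓ → Walk u w (suc ℓ)

  -- walks all of whose vertices satisfy P (walks in the induced subgraph on P)
  data WalkIn (P : Fin n → Set) : Fin n → Fin n → Set where
    hereIn : ∀ {u} → P u → WalkIn P u u
    stepIn : ∀ {u v w} → P u → Adj G u v → WalkIn P v w → WalkIn P u w

  Dist : Fin n → Fin n → ℕ → Set
  Dist u v d = Walk u v d × (∀ m → m < d → ¬ Walk u v m)

  Connected : Set
  Connected = ∀ u v → ∃ λ ℓ → Walk u v ℓ

  DiameterAtLeast2 : Set
  DiameterAtLeast2 = Σ (Fin n) λ u → Σ (Fin n) λ v → ¬ (u ≡ v) × ¬ Adj G u v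

  degree : Fin n → ℕ
  degree u = length (filter (adj? G u) (allFinL n))

  Regular : ℕ → Set
  Regular k = ∀ u → degree u ≡ k

  common : Fin n → Fin n → ℕ
  common u v = length (filter (λ w → adj? G u w ×-dec adj? G v w) (allFinL n))

  A1 : ℕ → Set
  A1 m = ∀ u v → Adj G u v → common u v ≡ m

  C2 : ℕ → Set
  C2 m = ∀ u v → Dist u v 2 → common u v ≡ m

  IsAut : Permutation′ n → Set
  IsAut σ = ∀ u v → (Adj G u v → Adj G (σ ⟨$⟩ʳ u) (σ ⟨$⟩ʳ v))
                  × (Adj G (σ ⟨$⟩ʳ u) (σ ⟨$⟩ʳ v) → Adj G u v)

  Aut : Set
  Aut = Σ (Permutation′ n) IsAut

  app : Aut → Fin n → Fin n
  app (σ , _) x = σ ⟨$⟩ʳ x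

  VertexTransitive : Set
  VertexTransitive = ∀ u v → Σ Aut λ g → app g u ≡ v

  StabTransitiveAt : ℕ → Set
  StabTransitiveAt i = ∀ u v w → Dist u v i → Dist u w i →
                         Σ Aut λ g → (app g u ≡ u) × (app g v ≡ w)

  TwoDistanceTransitive : Set
  TwoDistanceTransitive = DiameterAtLeast2 × VertexTransitive
                          × StabTransitiveAt 1 × StabTransitiveAt 2

  LocalDisconnected : Fin n → Set
  LocalDisconnected u = Σ (Fin n) λ v → Σ (Fin n) λ w →
                          Adj G u v × Adj G u w × ¬ WalkIn (Adj G u) v w

  IsBlockAt : Fin n → Subset n → Set
  IsBlockAt u B = (∀ x → x ∈ B → Adj G u x)
                × (∀ (g : Aut) → app g u ≡ u →
                     (∀ x → x ∈ B → app g x ∈ B) ⊎ (∀ x → x ∈ B → app g x ∉ B))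

  TrivialBlockAt : Fin n → Subset n → Set
  TrivialBlockAt u B = (∀ x y → x ∈ B → y ∈ B → x ≡ y) ⊎ (∀ x → Adj G u x → x ∈ B)

  PrimitiveAt : Fin n → Set
  PrimitiveAt u = (∀ v w → Adj G u v → Adj G u w →
                     Σ Aut λ g → (app g u ≡ u) × (app g v ≡ w))
                × (∀ B → IsBlockAt u B → TrivialBlockAt u B)

  LocallyPrimitive : Set
  LocallyPrimitive = ∀ u → PrimitiveAt u

  TwoArc : Fin n → Fin n → Fin n → Set
  TwoArc u₀ u₁ u₂ = Adj G u₀ u₁ × Adj G u₁ u₂ × ¬ (u₀ ≡ u₂)

  TwoArcTransitive : Set
  TwoArcTransitive = VertexTransitive
    × (∀ u₀ u₁ u₂ v₀ v₁ v₂ → TwoArc u₀ u₁ u₂ → TwoArc v₀ v₁ v₂ →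
         Σ Aut λ g → (app g u₀ ≡ v₀) × (app g u₁ ≡ v₁) × (app g u₂ ≡ v₂))

-- The connected components of the local graph [Γ(u)] are blocks of Aut(Γ)_u on Γ(u), so a
-- component containing an edge (which a₁ ≥ 1 provides) but not all of Γ(u) contradicts local
-- primitivity. If a₁ = 1 or c₂ = 1, then [Γ(u)] is a disjoint union of cliques, so two distinct
-- non-adjacent neighbours of u lie in different components. Such a pair exists wherever a path
-- leaves a closed neighbourhood (a 2-geodesic), and, when a₁ = 1, among any three neighbours.
-- When c₂ = 1 and Γ has a triangle, arc-transitivity puts every edge in a triangle, and no
-- automorphism maps a 2-arc inside a triangle to a 2-geodesic. Without triangles every 2-arc is a
-- 2-geodesic whose middle vertex is determined by its ends (c₂ = 1), so transitivity of
-- Aut(Γ)_u on Γ₂(u) makes Γ 2-arc-transitive.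
module Submission where

open import Defs
open import Data.Nat using (ℕ; _≤_; suc; s≤s; z≤n)
open import Data.Product using (Σ; ∃; ∃₂; _×_; _,_; proj₁; proj₂)
open import Data.Sum using (_⊎_; inj₁; inj₂; [_,_])
open import Relation.Nullary using (¬_; Dec; yes; no; contradiction)
open import Data.Bool using (T)
open import Data.Fin using (Fin; _≟_)
open import Data.Fin.Permutation using (_∘ₚ_)
open import Data.Fin.Properties using (any?; sequence)
open import Data.Fin.Subset using (Subset) renaming (_∈_ to _∈ₛ_; _∉_ to _∉ₛ_)
open import Data.List using (List; []; _∷_; length; filter; allFin)
open import Data.List.Membership.Propositional using (_∈_)
open import Data.List.Membership.Propositional.Properties using (∈-filter⁺; ∈-filter⁻; ∈-allFin)
open import Data.List.Relation.Unary.All using (_∷_)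
open import Data.List.Relation.Unary.AllPairs using (_∷_)
open import Data.List.Relation.Unary.Any using (here; there)
open import Data.List.Relation.Unary.Unique.Propositional using (Unique)
import Data.List.Relation.Unary.Unique.Propositional.Properties as Unique
open import Data.Unit using (tt)
open import Data.Vec using (tabulate)
open import Data.Vec.Properties using (lookup⇒[]=; []=⇒lookup; lookup∘tabulate)
open import Effect.Monad using (RawMonad)
open import Function using (_∘_; case_of_)
open import Function.Bundles using (Injection)
open import Function.Properties.Inverse using (↔⇒↣)
open import Relation.Binary.PropositionalEquality as ≡ using (_≡_; _≢_; refl; cong; subst; subst₂)
open import Relation.Nullary.Decidable using (_×-dec_; dec-true; isYes; isYes≗does; toWitness; ¬¬-excluded-middle)
open import Relation.Nullary.Negation using (¬¬-Monad)
open import Relation.Unary using (Decidable)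

module _ {A : Set} where

  nonempty⇒∃-member : {xs : List A} → 1 ≤ length xs → ∃ (_∈ xs)
  nonempty⇒∃-member {x ∷ _} _ = x , here refl

  length≡1⇒members-equal : ∀ {xs : List A} {x y} → length xs ≡ 1 → x ∈ xs → y ∈ xs → x ≡ y
  length≡1⇒members-equal {_ ∷ []} _ (here refl) (here refl) = refl

  unique∧3≤length⇒three-distinct : {xs : List A} → Unique xs → 3 ≤ length xs →
    ∃₂ λ a b → ∃ λ c → a ∈ xs × b ∈ xs × c ∈ xs × a ≢ b × a ≢ c × b ≢ c
  unique∧3≤length⇒three-distinct {a ∷ b ∷ c ∷ _} ((a≢b ∷ a≢c ∷ _) ∷ (b≢c ∷ _) ∷ _) _ =
    a , b , c , here refl , there (here refl) , there (there (here refl)) , a≢b , a≢c , b≢c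
  unique∧3≤length⇒three-distinct {[]} _ ()
  unique∧3≤length⇒three-distinct {_ ∷ []} _ (s≤s ())
  unique∧3≤length⇒three-distinct {_ ∷ _ ∷ []} _ (s≤s (s≤s ()))

module _ {n : ℕ} {P : Fin n → Set} (P? : Decidable P) where

  toSubset : Subset n
  toSubset = tabulate (isYes ∘ P?)

  ∈-toSubset⁺ : ∀ {x} → P x → x ∈ₛ toSubset
  ∈-toSubset⁺ {x} px = lookup⇒[]= x toSubset
    (≡.trans (lookup∘tabulate _ x) (≡.trans (isYes≗does (P? x)) (dec-true (P? x) px)))

  ∈-toSubset⁻ : ∀ {x} → x ∈ₛ toSubset → P x
  ∈-toSubset⁻ {x} x∈ = toWitness {a? = P? x}
    (subst T (≡.trans (≡.sym ([]=⇒lookup x∈)) (lookup∘tabulate _ x)) tt)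

module _ {n : ℕ} (G : Graph n) where

  private
    infix 4 _~_
    _~_ : Fin n → Fin n → Set
    _~_ = Adj G

    variable
      a b c p q u v w x y z u₀ u₁ u₂ v₀ v₁ v₂ : Fin n
      k ℓ m : ℕ

  adj⇒≢ : x ~ y → x ≢ y
  adj⇒≢ xy refl = irrefl G xy

  CommonNeighbour : Fin n → Fin n → Set
  CommonNeighbour u v = ∃ λ w → u ~ w × v ~ w

  private
    adjacent-to-both? : ∀ u v → Decidable (λ w → u ~ w × v ~ w)
    adjacent-to-both? u v w = adj? G u w ×-dec adj? G v w

    common-list : Fin n → Fin n → List (Fin n)
    common-list u v = filter (adjacent-to-both? u v) (allFin n)

  1≤common⇒CommonNeighbour : 1 ≤ common G u v → CommonNeighbour u v
  1≤common⇒CommonNeighbour {u} {v} 1≤common with nonempty⇒∃-member {xs = common-list u v} 1≤common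
  ... | w , w∈ = w , proj₂ (∈-filter⁻ (adjacent-to-both? u v) {xs = allFin n} w∈)

  common≡1⇒unique : common G u v ≡ 1 → u ~ a → v ~ a → u ~ b → v ~ b → a ≡ b
  common≡1⇒unique {u} {v} {a} {b} common≡1 ua va ub vb =
    length≡1⇒members-equal {xs = common-list u v} common≡1 (common-list-∈ ua va) (common-list-∈ ub vb)
    where
      common-list-∈ : u ~ w → v ~ w → w ∈ common-list u v
      common-list-∈ {w} uw vw = ∈-filter⁺ (adjacent-to-both? u v) (∈-allFin w) (uw , vw)

  3≤degree⇒three-neighbours : 3 ≤ degree G u →
    ∃₂ λ a b → ∃ λ c → u ~ a × u ~ b × u ~ c × a ≢ b × a ≢ c × b ≢ c
  3≤degree⇒three-neighbours {u} 3≤deg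
    with unique∧3≤length⇒three-distinct (Unique.filter⁺ (adj? G u) (Unique.allFin⁺ n)) 3≤deg
  ... | a , b , c , a∈ , b∈ , c∈ , a≢b , a≢c , b≢c =
    a , b , c , neighbour a∈ , neighbour b∈ , neighbour c∈ , a≢b , a≢c , b≢c
    where
      neighbour : w ∈ filter (adj? G u) (allFin n) → u ~ w
      neighbour = proj₂ ∘ ∈-filter⁻ (adj? G u) {xs = allFin n}

  a₁≥1⇒CommonNeighbour : A1 G m → 1 ≤ m → u ~ v → CommonNeighbour u v
  a₁≥1⇒CommonNeighbour a₁ 1≤m uv =
    1≤common⇒CommonNeighbour (subst (1 ≤_) (≡.sym (a₁ _ _ uv)) 1≤m)

  TwoGeodesic : Fin n → Fin n → Fin n → Set
  TwoGeodesic a b c = TwoArc G a b c × ¬ a ~ c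

  adj⇒dist₁ : x ~ y → Dist G x y 1
  adj⇒dist₁ xy = step xy here , λ { 0 _ here → irrefl G xy ; (suc _) (s≤s ()) _ }

  twoGeodesic⇒dist₂ : TwoGeodesic a b c → Dist G a c 2
  twoGeodesic⇒dist₂ ((ab , bc , a≢c) , ¬ac) = step ab (step bc here) , λ
    { 0 _ here → a≢c refl
    ; 1 _ (step ac here) → ¬ac ac
    ; (suc (suc _)) (s≤s (s≤s ())) _ }

  leave-closed-neighbourhood : z ≡ p ⊎ p ~ z → q ≢ p → ¬ p ~ q → Walk G z q ℓ →
                               ∃₂ λ x y → TwoGeodesic p x y
  leave-closed-neighbourhood (inj₁ refl) q≢p _ here = contradiction refl q≢p
  leave-closed-neighbourhood (inj₂ pq) _ ¬pq here = contradiction pq ¬pq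
  leave-closed-neighbourhood {p = p} z∈N[p] q≢p ¬pq (step {v = z′} zz′ walk) with z′ ≟ p | adj? G p z′
  ... | yes z′≡p | _ = leave-closed-neighbourhood (inj₁ z′≡p) q≢p ¬pq walk
  ... | no _ | yes pz′ = leave-closed-neighbourhood (inj₂ pz′) q≢p ¬pq walk
  ... | no z′≢p | no ¬pz′ with z∈N[p]
  ...   | inj₁ refl = contradiction zz′ ¬pz′
  ...   | inj₂ pz = _ , z′ , (pz , zz′ , z′≢p ∘ ≡.sym) , ¬pz′

  ∃-twoGeodesic : Connected G → DiameterAtLeast2 G → ∃ λ p → ∃₂ λ x y → TwoGeodesic p x y
  ∃-twoGeodesic conn (p , q , p≢q , ¬pq) =
    p , leave-closed-neighbourhood (inj₁ refl) (p≢q ∘ ≡.sym) ¬pq (proj₂ (conn p q))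

  preserves : (g : Aut G) → x ~ y → app G g x ~ app G g y
  preserves (_ , aut) = proj₁ (aut _ _)

  reflects : (g : Aut G) → app G g x ~ app G g y → x ~ y
  reflects (_ , aut) = proj₂ (aut _ _)

  maps-edge : (g : Aut G) → app G g x ≡ u → app G g y ≡ v → x ~ y → u ~ v
  maps-edge g gx≡u gy≡v xy = subst₂ _~_ gx≡u gy≡v (preserves g xy)

  app-injective : (g : Aut G) → app G g x ≡ app G g y → x ≡ y
  app-injective (σ , _) = Injection.injective (↔⇒↣ σ)

  infixl 5 _⨾_
  _⨾_ : Aut G → Aut G → Aut G
  g ⨾ h = proj₁ g ∘ₚ proj₁ h , λ _ _ → preserves h ∘ preserves g , reflects g ∘ reflects h

  maps-twoGeodesic : (g : Aut G) → app G g a ≡ u → TwoGeodesic a b c →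
                     TwoGeodesic u (app G g b) (app G g c)
  maps-twoGeodesic g ga≡u ((ab , bc , a≢c) , ¬ac) =
    (maps-edge g ga≡u refl ab , preserves g bc , λ u≡gc → a≢c (app-injective g (≡.trans ga≡u u≡gc))) ,
    λ u~gc → ¬ac (reflects g (subst (_~ _) (≡.sym ga≡u) u~gc))

  arc-transitive : VertexTransitive G → StabTransitiveAt G 1 → u ~ v → x ~ y →
                   Σ (Aut G) λ g → app G g u ≡ x × app G g v ≡ y
  arc-transitive {u} {v} {x} {y} vt st₁ uv xy with vt u x
  ... | h , hu≡x with st₁ x (app G h v) y (adj⇒dist₁ (maps-edge h hu≡x refl uv)) (adj⇒dist₁ xy)
  ... | g , gx≡x , ghv≡y = h ⨾ g , ≡.trans (cong (app G g) hu≡x) gx≡x , ghv≡y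

  module _ {P : Fin n → Set} where

    walkIn-start : WalkIn G P a b → P a
    walkIn-start (hereIn pa) = pa
    walkIn-start (stepIn pa _ _) = pa

    walkIn-end : WalkIn G P a b → P b
    walkIn-end (hereIn pb) = pb
    walkIn-end (stepIn _ _ walk) = walkIn-end walk

    infixr 5 _++ᵂ_
    _++ᵂ_ : WalkIn G P a b → WalkIn G P b c → WalkIn G P a c
    hereIn _ ++ᵂ walk′ = walk′
    stepIn pa ab walk ++ᵂ walk′ = stepIn pa ab (walk ++ᵂ walk′)

    reverseᵂ : WalkIn G P a b → WalkIn G P b a
    reverseᵂ (hereIn pa) = hereIn pa
    reverseᵂ (stepIn pa ab walk) = reverseᵂ walk ++ᵂ stepIn (walkIn-start walk) (G .sym ab) (hereIn pa)

  mapᵂ-stabiliser : (g : Aut G) → app G g u ≡ u →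
                    WalkIn G (u ~_) a b → WalkIn G (u ~_) (app G g a) (app G g b)
  mapᵂ-stabiliser g gu≡u (hereIn ua) = hereIn (maps-edge g gu≡u refl ua)
  mapᵂ-stabiliser g gu≡u (stepIn ua ab walk) =
    stepIn (maps-edge g gu≡u refl ua) (preserves g ab) (mapᵂ-stabiliser g gu≡u walk)

  component-isBlock : (C? : Decidable (WalkIn G (u ~_) v)) → IsBlockAt G u (toSubset C?)
  proj₁ (component-isBlock C?) x x∈ = walkIn-end (∈-toSubset⁻ C? x∈)
  proj₂ (component-isBlock {v = v} C?) g gu≡u with C? (app G g v)
  ... | yes v⇝gv = inj₁ λ x x∈ → ∈-toSubset⁺ C? (v⇝gv ++ᵂ mapᵂ-stabiliser g gu≡u (∈-toSubset⁻ C? x∈))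
  ... | no ¬v⇝gv = inj₂ λ x x∈ gx∈ →
    ¬v⇝gv (∈-toSubset⁻ C? gx∈ ++ᵂ reverseᵂ (mapᵂ-stabiliser g gu≡u (∈-toSubset⁻ C? x∈)))

  nontrivial-block⇒¬primitive : {B : Subset n} → IsBlockAt G u B →
    a ∈ₛ B → b ∈ₛ B → a ≢ b → u ~ c → c ∉ₛ B → ¬ PrimitiveAt G u
  nontrivial-block⇒¬primitive isBlock a∈ b∈ a≢b uc c∉ (_ , blocks-trivial)
    with blocks-trivial _ isBlock
  ... | inj₁ singleton = a≢b (singleton _ _ a∈ b∈)
  ... | inj₂ everything = c∉ (everything _ uc)

  local-component⇒¬primitive : u ~ v → CommonNeighbour u v → u ~ w → ¬ WalkIn G (u ~_) v w →
                               ¬ PrimitiveAt G u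
  -- A block must be a decidable subset; as the goal is ⊥, membership in the component of v may be
  -- assumed decidable vertex by vertex (excluded middle in the double-negation monad).
  local-component⇒¬primitive uv (r , ur , vr) uw ¬v⇝w primitiveAt-u =
    sequence (RawMonad.rawApplicative ¬¬-Monad) (λ _ → ¬¬-excluded-middle) λ C? →
      nontrivial-block⇒¬primitive (component-isBlock C?)
        (∈-toSubset⁺ C? (hereIn uv)) (∈-toSubset⁺ C? (stepIn uv vr (hereIn ur))) (adj⇒≢ vr)
        uw (¬v⇝w ∘ ∈-toSubset⁻ C?) primitiveAt-u

  LocalClusterGraph : Fin n → Set
  LocalClusterGraph u = ∀ {a b c} → u ~ a → u ~ b → u ~ c → a ~ b → b ~ c → a ≡ c ⊎ a ~ c

  a₁≡1⇒localClusterGraph : A1 G 1 → LocalClusterGraph u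
  a₁≡1⇒localClusterGraph a₁ ua ub uc ab bc =
    inj₁ (common≡1⇒unique (a₁ _ _ ub) ua (G .sym ab) uc bc)

  c₂≡1⇒localClusterGraph : C2 G 1 → LocalClusterGraph u
  c₂≡1⇒localClusterGraph c₂ {a} {_} {c} ua ub uc ab bc with a ≟ c | adj? G a c
  ... | yes a≡c | _ = inj₁ a≡c
  ... | no _ | yes ac = inj₂ ac
  ... | no a≢c | no ¬ac = contradiction
    (common≡1⇒unique (c₂ _ _ (twoGeodesic⇒dist₂ ((ab , bc , a≢c) , ¬ac)))
      (G .sym ua) (G .sym uc) ab (G .sym bc))
    (adj⇒≢ ub)

  localClusterGraph⇒walkIn-short : LocalClusterGraph u → WalkIn G (u ~_) a b → a ≡ b ⊎ a ~ b
  localClusterGraph⇒walkIn-short cluster (hereIn _) = inj₁ refl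
  localClusterGraph⇒walkIn-short cluster (stepIn ua ab walk)
    with localClusterGraph⇒walkIn-short cluster walk
  ... | inj₁ refl = inj₂ ab
  ... | inj₂ bc = cluster ua (walkIn-start walk) (walkIn-end walk) ab bc

  localClusterGraph⇒¬primitive : LocalClusterGraph u → TwoGeodesic v u w → CommonNeighbour u v →
                                 ¬ PrimitiveAt G u
  localClusterGraph⇒¬primitive cluster ((vu , uw , v≢w) , ¬vw) uv-triangle =
    local-component⇒¬primitive (G .sym vu) uv-triangle uw
      ([ v≢w , ¬vw ] ∘ localClusterGraph⇒walkIn-short cluster)

  a₁≡1∧3≤degree⇒twoGeodesic : A1 G 1 → 3 ≤ degree G u → ∃₂ λ a b → TwoGeodesic a u b
  a₁≡1∧3≤degree⇒twoGeodesic {u} a₁ 3≤deg with 3≤degree⇒three-neighbours 3≤deg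
  ... | a , b , c , ua , ub , uc , a≢b , a≢c , b≢c with adj? G a b | adj? G a c
  ... | no ¬ab | _ = a , b , (G .sym ua , ub , a≢b) , ¬ab
  ... | yes _ | no ¬ac = a , c , (G .sym ua , uc , a≢c) , ¬ac
  ... | yes ab | yes ac = contradiction (common≡1⇒unique (a₁ u a ua) ub ab uc ac) b≢c

  Triangle : Set
  Triangle = ∃₂ λ s t → s ~ t × CommonNeighbour s t

  triangle? : Dec Triangle
  triangle? = any? λ s → any? λ t → adj? G s t ×-dec any? λ r → adj? G s r ×-dec adj? G t r

  triangle⇒edge-in-triangle : VertexTransitive G → StabTransitiveAt G 1 → Triangle →
                              x ~ y → CommonNeighbour x y
  triangle⇒edge-in-triangle vt st₁ (s , t , st , r , sr , tr) xy with arc-transitive vt st₁ st xy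
  ... | g , gs≡x , gt≡y = app G g r , maps-edge g gs≡x refl sr , maps-edge g gt≡y refl tr

  triangle⇒¬twoArcTransitive : Triangle → TwoGeodesic p x y → ¬ TwoArcTransitive G
  triangle⇒¬twoArcTransitive (s , t , st , r , sr , tr) (pxy , ¬py) (_ , two-arc-transitive)
    with two-arc-transitive t s r _ _ _ (G .sym st , sr , adj⇒≢ tr) pxy
  ... | g , gt≡p , _ , gr≡y = ¬py (maps-edge g gt≡p gr≡y tr)

  triangle-free⇒twoGeodesic : ¬ Triangle → TwoArc G a b c → TwoGeodesic a b c
  triangle-free⇒twoGeodesic ¬triangle arc@(ab , bc , _) =
    arc , λ ac → ¬triangle (_ , _ , ac , _ , ab , G .sym bc)

  c₂≡1⇒twoGeodesic-transitive : VertexTransitive G → StabTransitiveAt G 2 → C2 G 1 →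
    TwoGeodesic u₀ u₁ u₂ → TwoGeodesic v₀ v₁ v₂ →
    Σ (Aut G) λ g → app G g u₀ ≡ v₀ × app G g u₁ ≡ v₁ × app G g u₂ ≡ v₂
  c₂≡1⇒twoGeodesic-transitive {u₀} {u₁} {u₂} {v₀} {v₁} {v₂} vt st₂ c₂
    u-geodesic@((u₀u₁ , u₁u₂ , _) , _) v-geodesic@((v₀v₁ , v₁v₂ , _) , _) with vt u₀ v₀
  ... | h , hu₀≡v₀
    with st₂ v₀ (app G h u₂) v₂ (twoGeodesic⇒dist₂ (maps-twoGeodesic h hu₀≡v₀ u-geodesic))
                                (twoGeodesic⇒dist₂ v-geodesic)
  ... | g , gv₀≡v₀ , ghu₂≡v₂ = h ⨾ g , ku₀≡v₀ , ku₁≡v₁ , ghu₂≡v₂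
    where
      ku₀≡v₀ : app G (h ⨾ g) u₀ ≡ v₀
      ku₀≡v₀ = ≡.trans (cong (app G g) hu₀≡v₀) gv₀≡v₀
      ku₁≡v₁ : app G (h ⨾ g) u₁ ≡ v₁
      ku₁≡v₁ = common≡1⇒unique (c₂ _ _ (twoGeodesic⇒dist₂ v-geodesic))
                 (maps-edge (h ⨾ g) ku₀≡v₀ refl u₀u₁) (G .sym (maps-edge (h ⨾ g) refl ghu₂≡v₂ u₁u₂))
                 v₀v₁ (G .sym v₁v₂)

  triangle-free∧c₂≡1⇒twoArcTransitive : VertexTransitive G → StabTransitiveAt G 2 → C2 G 1 →
                                        ¬ Triangle → TwoArcTransitive G
  triangle-free∧c₂≡1⇒twoArcTransitive vt st₂ c₂ ¬triangle = vt , λ _ _ _ _ _ _ u-arc v-arc →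
    c₂≡1⇒twoGeodesic-transitive vt st₂ c₂
      (triangle-free⇒twoGeodesic ¬triangle u-arc) (triangle-free⇒twoGeodesic ¬triangle v-arc)

  module _ (conn : Connected G) (diam : DiameterAtLeast2 G) where

    private
      geodesic : ∃ λ p → ∃₂ λ x y → TwoGeodesic p x y
      geodesic = ∃-twoGeodesic conn diam

    c₂≡1∧a₁≥1⇒¬locallyPrimitive : C2 G 1 → A1 G m → 1 ≤ m → ¬ LocallyPrimitive G
    c₂≡1∧a₁≥1⇒¬locallyPrimitive c₂ a₁ 1≤m locallyPrimitive with geodesic
    ... | _ , x , _ , pxy@((px , _) , _) =
      localClusterGraph⇒¬primitive (c₂≡1⇒localClusterGraph c₂) pxy
        (a₁≥1⇒CommonNeighbour a₁ 1≤m (G .sym px)) (locallyPrimitive x)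

    c₂≡1∧triangle⇒neither : VertexTransitive G → StabTransitiveAt G 1 → C2 G 1 → Triangle →
                            ¬ TwoArcTransitive G × ¬ LocallyPrimitive G
    c₂≡1∧triangle⇒neither vt st₁ c₂ triangle with geodesic
    ... | _ , x , _ , pxy@((px , _) , _) =
      triangle⇒¬twoArcTransitive triangle pxy , λ locallyPrimitive →
        localClusterGraph⇒¬primitive (c₂≡1⇒localClusterGraph c₂) pxy
          (triangle⇒edge-in-triangle vt st₁ triangle (G .sym px)) (locallyPrimitive x)

  a₁≥1∧locallyDisconnected⇒¬locallyPrimitive : A1 G m → 1 ≤ m → (∃ λ u → LocalDisconnected G u) →
                                               ¬ LocallyPrimitive G
  a₁≥1∧locallyDisconnected⇒¬locallyPrimitive a₁ 1≤m (u , v , w , uv , uw , ¬v⇝w) locallyPrimitive =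
    local-component⇒¬primitive uv (a₁≥1⇒CommonNeighbour a₁ 1≤m uv) uw ¬v⇝w (locallyPrimitive u)

  a₁≡1⇒¬locallyPrimitive : Fin n → Regular G k → 3 ≤ k → A1 G 1 → ¬ LocallyPrimitive G
  a₁≡1⇒¬locallyPrimitive u reg 3≤k a₁ locallyPrimitive
    with a₁≡1∧3≤degree⇒twoGeodesic a₁ (subst (3 ≤_) (≡.sym (reg u)) 3≤k)
  ... | _ , _ , aub@((au , _) , _) =
    localClusterGraph⇒¬primitive (a₁≡1⇒localClusterGraph a₁) aub
      (a₁≥1⇒CommonNeighbour a₁ (s≤s z≤n) (G .sym au)) (locallyPrimitive u)

lemma6p4 : ∀ {n} (G : Graph n) (k : ℕ) →
    Connected G → TwoDistanceTransitive G → Regular G k → 3 ≤ k →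
    (∀ a → A1 G a → 1 ≤ a → (∃ λ u → LocalDisconnected G u) → ¬ LocallyPrimitive G)
    × (A1 G 1 → ¬ LocallyPrimitive G)
    × (∀ a → A1 G a → C2 G 1 → 1 ≤ a → ¬ LocallyPrimitive G)
    × (C2 G 1 → TwoArcTransitive G ⊎ (¬ TwoArcTransitive G × ¬ LocallyPrimitive G))
lemma6p4 G k conn (diam@(u , _) , vt , st₁ , st₂) reg 3≤k =
  (λ _ → a₁≥1∧locallyDisconnected⇒¬locallyPrimitive G) ,
  a₁≡1⇒¬locallyPrimitive G u reg 3≤k ,
  (λ _ a₁ c₂ → c₂≡1∧a₁≥1⇒¬locallyPrimitive G conn diam c₂ a₁) ,
  λ c₂ → case triangle? G of λ
    { (no ¬triangle) → inj₁ (triangle-free∧c₂≡1⇒twoArcTransitive G vt st₂ c₂ ¬triangle)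
    ; (yes triangle) → inj₂ (c₂≡1∧triangle⇒neither G conn diam vt st₁ c₂ triangle) }
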